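{- Let $A=\{a_1,\dots,a_n\}$ be an orthonormal basis of $V_A=\mathbb{R}^n$, let $S$ be a two-dimensional real vector space with basis $\{\top,\bot\}$, and let $C_1,\dots,C_k$ be non-empty sets partitioning $A$, with $m_j=|C_j|$. Let $C=\{c_1,\dots,c_k\}$ be an orthonormal basis of $V_C=\mathbb{R}^k$. For a predicate $p$ on $A$ let $n_{pC_j}$ be the number of $a\in C_j$ with $p(a)=\top$ and define $\mathcal{J}_C(p)=\sum_{j=1}^k (n_{pC_j}/m_j)\,c_j$. Let $p,q:V_A\to S$ be predicates on $A$ such that for every $j=1,\dots,k$ at least one of $p$, $q$ is constant on $C_j$. Then $$\mathcal{J}_C(\mathrm{and}\circ\langle p,q\rangle)=\mathcal{J}_C(p)\wedge\mathcal{J}_C(q),\quad \mathcal{J}_C(\mathrm{or}\circ\langle p,q\rangle)=\mathcal{J}_C(p)\vee\mathcal{J}_C(q),\quad \mathcal{J}_C(\mathrm{ifthen}\circ\langle p,q\rangle)=\mathcal{J}_C(p)\rightarrow\mathcal{J}_C(q).$$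
   Context: A predicate on $A$ is a linear map $p:V_A\to S$ with $p(a)\in\{\top,\bot\}$ for every $a\in A$. The logical connectives are the linear maps $\mathrm{not}:S\to S$ with $\mathrm{not}(\top)=\bot$, $\mathrm{not}(\bot)=\top$, and $\mathrm{and},\mathrm{or},\mathrm{ifthen}:S\otimes S\to S$ given on basis vectors by: $\mathrm{and}(z)=\top$ iff $z=\top\otimes\top$, else $\bot$; $\mathrm{or}(z)=\bot$ iff $z=\bot\otimes\bot$, else $\top$; $\mathrm{ifthen}(z)=\bot$ iff $z=\top\otimes\bot$, else $\top$. With $d_A:V_A\to V_A\otimes V_A$ the linear map $d_A(a_i)=a_i\otimes a_i$, set $\langle p,q\rangle=(p\otimes q)\circ d_A$. The algebraic connectives on scalars are $\neg\alpha=1-\alpha$, $\alpha\wedge\beta=\alpha\beta$, $\alpha\vee\beta=\alpha+\beta-\alpha\beta$, $\alpha\rightarrow\beta=1-\alpha+\alpha\beta$, and they are applied to vectors of $V_C$ coordinatewise with respect to the basis $C$.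
   Formalization: The spaces V_A, S and V_C are taken over ℚ instead of ℝ, so the predicates p, q are ℚ-linear and the values of $\mathcal{J}_C$ are rational. -}

module Defs where

open import Data.Nat as ℕ using (ℕ; zero; suc)
open import Data.Integer using (+_)
open import Data.Fin using (Fin; zero; suc)
open import Data.Fin.Properties using () renaming (_≟_ to _≟F_)
open import Data.Product using (_×_; _,_)
open import Data.Bool using (Bool; true; false; _∧_; if_then_else_)
open import Data.Rational using (ℚ; 0ℚ; 1ℚ; _+_; _*_; _-_; _/_)
open import Data.Rational.Properties using () renaming (_≟_ to _≟ℚ_)
open import Relation.Nullary.Decidable using (⌊_⌋)
open import Relation.Binary.PropositionalEquality using (_≡_)
open import Data.Sum using (_⊎_)

-- Vectors of ℚ^I are functions I → ℚ (coordinates w.r.t. the standard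
-- orthonormal basis indexed by I).  A linear map ℚ^I → ℚ^J is given by its
-- matrix: Lin I J = J → I → ℚ, entry (j , i) = j-th coordinate of the
-- image of the i-th basis vector.
Lin : Set → Set → Set
Lin I J = J → I → ℚ

sumFin : (n : ℕ) → (Fin n → ℚ) → ℚ
sumFin zero    f = 0ℚ
sumFin (suc n) f = f zero + sumFin n (λ i → f (suc i))

sum2 : (n m : ℕ) → (Fin n × Fin m → ℚ) → ℚ
sum2 n m f = sumFin n (λ i → sumFin m (λ j → f (i , j)))

_∘₂_ : {I J : Set} {n m : ℕ} → Lin (Fin n × Fin m) J → Lin I (Fin n × Fin m) → Lin I J
_∘₂_ {n = n} {m = m} g f j i = sum2 n m (λ x → g j x * f x i)

_⊗_ : {I I' J J' : Set} → Lin I J → Lin I' J' → Lin (I × I') (J × J')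
(p ⊗ q) (j , j') (i , i') = p j i * q j' i'

δ : {n : ℕ} → Fin n → Fin n → ℚ
δ i j = if ⌊ i ≟F j ⌋ then 1ℚ else 0ℚ

-- S = ℚ^2 with basis ⊤ (index 0) and ⊥ (index 1)
S : Set
S = Fin 2

⊤ₛ ⊥ₛ : S
⊤ₛ = zero
⊥ₛ = suc zero

d : (n : ℕ) → Lin (Fin n) (Fin n × Fin n)
d n (i , i') k = δ i k * δ i' k

⟨_,_⟩ : {n : ℕ} → Lin (Fin n) S → Lin (Fin n) S → Lin (Fin n) (S × S)
⟨_,_⟩ {n} p q = (p ⊗ q) ∘₂ d n

fromTable : (S → S → S) → Lin (S × S) S
fromTable t s (x , y) = δ (t x y) s

andT orT ifthenT : S → S → S
andT zero zero = ⊤ₛ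
andT _    _    = ⊥ₛ
orT (suc zero) (suc zero) = ⊥ₛ
orT _          _          = ⊤ₛ
ifthenT zero (suc zero) = ⊥ₛ
ifthenT _    _          = ⊤ₛ

and or ifthen : Lin (S × S) S
and    = fromTable andT
or     = fromTable orT
ifthen = fromTable ifthenT

_∘⟨_,_⟩ : {n : ℕ} → Lin (S × S) S → Lin (Fin n) S → Lin (Fin n) S → Lin (Fin n) S
L ∘⟨ p , q ⟩ = L ∘₂ ⟨ p , q ⟩

_maps_to_ : {n : ℕ} → Lin (Fin n) S → Fin n → S → Set
p maps i to t = (s : S) → p s i ≡ δ t s

IsPredicate : {n : ℕ} → Lin (Fin n) S → Set
IsPredicate {n} p = (i : Fin n) → (p maps i to ⊤ₛ) ⊎ (p maps i to ⊥ₛ)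

isTop : {n : ℕ} → Lin (Fin n) S → Fin n → Bool
isTop p i = ⌊ p ⊤ₛ i ≟ℚ 1ℚ ⌋ ∧ ⌊ p ⊥ₛ i ≟ℚ 0ℚ ⌋

count : (n : ℕ) → (Fin n → Bool) → ℕ
count zero    b = zero
count (suc n) b = (if b zero then 1 else 0) ℕ.+ count n (λ i → b (suc i))

-- the partition C_1,…,C_k of A is given by cls : Fin n → Fin k,
-- C_j = { a_i | cls i ≡ j }
inBlock : {n k : ℕ} → (Fin n → Fin k) → Fin k → Fin n → Bool
inBlock cls j i = ⌊ cls i ≟F j ⌋

m : {n k : ℕ} → (Fin n → Fin k) → Fin k → ℕ
m {n} cls j = count n (inBlock cls j)

nP : {n k : ℕ} → (Fin n → Fin k) → Lin (Fin n) S → Fin k → ℕ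
nP {n} cls p j = count n (λ i → inBlock cls j i ∧ isTop p i)

-- a / b for natural numbers (b = 0 never occurs: blocks are non-empty)
_÷ℕ_ : ℕ → ℕ → ℚ
a ÷ℕ zero    = 0ℚ
a ÷ℕ (suc b) = (+ a) / suc b

𝒥 : {n k : ℕ} → (Fin n → Fin k) → Lin (Fin n) S → Fin k → ℚ
𝒥 cls p j = nP cls p j ÷ℕ m cls j

¬ₐ : ℚ → ℚ
¬ₐ α = 1ℚ - α
_∧ₐ_ _∨ₐ_ _→ₐ_ : ℚ → ℚ → ℚ
α ∧ₐ β = α * β
α ∨ₐ β = (α + β) - α * β
α →ₐ β = (1ℚ - α) + α * β

_∧ᵥ_ _∨ᵥ_ _→ᵥ_ : {k : ℕ} → (Fin k → ℚ) → (Fin k → ℚ) → (Fin k → ℚ)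
(u ∧ᵥ v) j = u j ∧ₐ v j
(u ∨ᵥ v) j = u j ∨ₐ v j
(u →ᵥ v) j = u j →ₐ v j

ConstOn : {n k : ℕ} → (Fin n → Fin k) → Lin (Fin n) S → Fin k → Set
ConstOn cls p j = ∀ i i' → cls i ≡ j
                        → cls i' ≡ j
                        → (s : S) → p s i ≡ p s i'

-- Everything happens block by block.  Write J(r) for the fraction of a block C
-- on which r is ⊤.  If p is constant on C, then and ∘ ⟨p,q⟩ agrees with q on C
-- when p is ⊤ there and is ⊥ on C when p is ⊥, so its fraction is J(p) · J(q)
-- with J(p) ∈ {1, 0}; symmetrically when q is constant.  Negation turns J into
-- 1 − J, and or(x,y) = not(and(not x, not y)), ifthen(x,y) = not(and(x, not y)),
-- so the other two identities follow from the first by De Morgan's laws for the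
-- Boolean and for the algebraic connectives.
module Submission where

open import Defs
open import Data.Nat as ℕ using (ℕ; zero; suc; _<_; z<s; NonZero; >-nonZero)
open import Data.Nat.Properties using (+-suc; m≤n+m; <-≤-trans)
open import Data.Fin using (Fin; zero; suc)
open import Data.Fin.Properties using () renaming (_≟_ to _≟F_)
open import Data.Product using (Σ; _×_; _,_; proj₁; proj₂)
open import Data.Sum as Sum using (_⊎_; inj₁; inj₂; [_,_]′)
open import Data.Bool using (Bool; true; false; _∧_; _∨_; not; if_then_else_)
open import Data.Bool.Properties using (∧-identityʳ; ∧-zeroʳ; ∧-comm; not-involutive)
import Data.Integer as ℤ
open import Data.Integer.Properties using (pos-+) renaming (*-comm to ℤ-*-comm)
import Data.Integer.Solver as ℤ-Solver
open import Data.Rational using (ℚ; 0ℚ; 1ℚ; _+_; _*_; _-_; toℚᵘ)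
open import Data.Rational.Properties
  using (+-identityʳ; +-identityˡ; *-identityʳ; *-identityˡ; *-zeroʳ; *-zeroˡ; *-assoc; *-comm;
         0/n≡0; toℚᵘ-injective; toℚᵘ-fromℚᵘ; toℚᵘ-homo-+; fromℚᵘ-cong)
  renaming (_≟_ to _≟ℚ_)
open import Data.Rational.Solver using (module +-*-Solver)
open import Data.Rational.Unnormalised as ℚᵘ using (mkℚᵘ; *≡*)
import Data.Rational.Unnormalised.Properties as ℚᵘ
open import Relation.Binary.PropositionalEquality
  using (_≡_; refl; sym; trans; cong; cong₂; module ≡-Reasoning)
open import Relation.Nullary using (yes; no; contradiction)
open import Relation.Nullary.Decidable using (⌊_⌋)

sumFin-cong : ∀ n {f g : Fin n → ℚ} → (∀ i → f i ≡ g i) → sumFin n f ≡ sumFin n g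
sumFin-cong zero    eq = refl
sumFin-cong (suc n) eq = cong₂ _+_ (eq zero) (sumFin-cong n (λ i → eq (suc i)))

sumFin-zero : ∀ n → sumFin n (λ _ → 0ℚ) ≡ 0ℚ
sumFin-zero zero    = refl
sumFin-zero (suc n) = trans (cong (0ℚ +_) (sumFin-zero n)) (+-identityʳ 0ℚ)

δ-suc : ∀ {n} (a i : Fin n) → δ (suc a) (suc i) ≡ δ a i
δ-suc a i with a ≟F i
... | yes _ = refl
... | no  _ = refl

δ-sym : ∀ {n} (a i : Fin n) → δ a i ≡ δ i a
δ-sym a i with a ≟F i | i ≟F a
... | yes _   | yes _   = refl
... | no  _   | no  _   = refl
... | yes a≡i | no  i≢a = contradiction (sym a≡i) i≢a
... | no  a≢i | yes i≡a = contradiction (sym i≡a) a≢i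

sumFin-δ : ∀ n (f : Fin n → ℚ) (i : Fin n) → sumFin n (λ a → f a * δ a i) ≡ f i
sumFin-δ (suc n) f zero = begin
  f zero * 1ℚ + sumFin n (λ a → f (suc a) * 0ℚ)
    ≡⟨ cong₂ _+_ (*-identityʳ (f zero)) (sumFin-cong n (λ a → *-zeroʳ (f (suc a)))) ⟩
  f zero + sumFin n (λ _ → 0ℚ)
    ≡⟨ cong (f zero +_) (sumFin-zero n) ⟩
  f zero + 0ℚ
    ≡⟨ +-identityʳ (f zero) ⟩
  f zero ∎
  where open ≡-Reasoning
sumFin-δ (suc n) f (suc i) = begin
  f zero * 0ℚ + sumFin n (λ a → f (suc a) * δ (suc a) (suc i))
    ≡⟨ cong₂ _+_ (*-zeroʳ (f zero)) (sumFin-cong n (λ a → cong (f (suc a) *_) (δ-suc a i))) ⟩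
  0ℚ + sumFin n (λ a → f (suc a) * δ a i)
    ≡⟨ +-identityˡ _ ⟩
  sumFin n (λ a → f (suc a) * δ a i)
    ≡⟨ sumFin-δ n (λ a → f (suc a)) i ⟩
  f (suc i) ∎
  where open ≡-Reasoning

sum2-δ : ∀ n m (F : Fin n → Fin m → ℚ) (i : Fin n) (j : Fin m)
         → sum2 n m (λ (a , b) → F a b * (δ a i * δ b j)) ≡ F i j
sum2-δ n m F i j = begin
  sumFin n (λ a → sumFin m (λ b → F a b * (δ a i * δ b j)))
    ≡⟨ sumFin-cong n (λ a → sumFin-cong m (λ b → sym (*-assoc (F a b) (δ a i) (δ b j)))) ⟩
  sumFin n (λ a → sumFin m (λ b → F a b * δ a i * δ b j))
    ≡⟨ sumFin-cong n (λ a → sumFin-δ m (λ b → F a b * δ a i) j) ⟩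
  sumFin n (λ a → F a j * δ a i)
    ≡⟨ sumFin-δ n (λ a → F a j) i ⟩
  F i j ∎
  where open ≡-Reasoning

⟨,⟩-apply : ∀ {n} (p q : Lin (Fin n) S) x y i → ⟨ p , q ⟩ (x , y) i ≡ p x i * q y i
⟨,⟩-apply {n} p q x y i = sum2-δ n n (λ a b → p x a * q y b) i i

fromTable-∘⟨,⟩-maps : ∀ {n} (t : S → S → S) (p q : Lin (Fin n) S) {i x y}
                      → p maps i to x → q maps i to y
                      → (fromTable t ∘⟨ p , q ⟩) maps i to t x y
fromTable-∘⟨,⟩-maps t p q {i} {x} {y} px qy s = begin
  sum2 2 2 (λ (x′ , y′) → δ (t x′ y′) s * ⟨ p , q ⟩ (x′ , y′) i)
    ≡⟨ sumFin-cong 2 (λ x′ → sumFin-cong 2 (λ y′ → cong (δ (t x′ y′) s *_) (value x′ y′))) ⟩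
  sum2 2 2 (λ (x′ , y′) → δ (t x′ y′) s * (δ x′ x * δ y′ y))
    ≡⟨ sum2-δ 2 2 (λ x′ y′ → δ (t x′ y′) s) x y ⟩
  δ (t x y) s ∎
  where
  open ≡-Reasoning
  value : ∀ x′ y′ → ⟨ p , q ⟩ (x′ , y′) i ≡ δ x′ x * δ y′ y
  value x′ y′ = trans (⟨,⟩-apply p q x′ y′ i)
                      (cong₂ _*_ (trans (px x′) (δ-sym x x′)) (trans (qy y′) (δ-sym y y′)))

isTopₛ : S → Bool
isTopₛ zero    = true
isTopₛ (suc _) = false

isTop-maps : ∀ {n} (p : Lin (Fin n) S) {i s} → p maps i to s → isTop p i ≡ isTopₛ s
isTop-maps p {s = s} ps rewrite ps ⊤ₛ | ps ⊥ₛ = isTop-δ s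
  where
  isTop-δ : ∀ s → (⌊ δ s ⊤ₛ ≟ℚ 1ℚ ⌋ ∧ ⌊ δ s ⊥ₛ ≟ℚ 0ℚ ⌋) ≡ isTopₛ s
  isTop-δ zero       = refl
  isTop-δ (suc zero) = refl

isTopₛ-andT : ∀ x y → isTopₛ (andT x y) ≡ (isTopₛ x ∧ isTopₛ y)
isTopₛ-andT zero       zero       = refl
isTopₛ-andT zero       (suc zero) = refl
isTopₛ-andT (suc zero) zero       = refl
isTopₛ-andT (suc zero) (suc zero) = refl

isTopₛ-orT : ∀ x y → isTopₛ (orT x y) ≡ (isTopₛ x ∨ isTopₛ y)
isTopₛ-orT zero       zero       = refl
isTopₛ-orT zero       (suc zero) = refl
isTopₛ-orT (suc zero) zero       = refl
isTopₛ-orT (suc zero) (suc zero) = refl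

isTopₛ-ifthenT : ∀ x y → isTopₛ (ifthenT x y) ≡ (not (isTopₛ x) ∨ isTopₛ y)
isTopₛ-ifthenT zero       zero       = refl
isTopₛ-ifthenT zero       (suc zero) = refl
isTopₛ-ifthenT (suc zero) zero       = refl
isTopₛ-ifthenT (suc zero) (suc zero) = refl

predicate-value : ∀ {n} {p : Lin (Fin n) S} → IsPredicate p → ∀ i → Σ S (λ s → p maps i to s)
predicate-value P i = [ (⊤ₛ ,_) , (⊥ₛ ,_) ]′ (P i)

isTop-∘⟨,⟩ : ∀ {n} (t : S → S → S) (_•_ : Bool → Bool → Bool)
             → (∀ x y → isTopₛ (t x y) ≡ (isTopₛ x • isTopₛ y))
             → {p q : Lin (Fin n) S} → IsPredicate p → IsPredicate q
             → ∀ i → isTop (fromTable t ∘⟨ p , q ⟩) i ≡ (isTop p i • isTop q i)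
isTop-∘⟨,⟩ t _•_ table {p} {q} P Q i with predicate-value P i | predicate-value Q i
... | x , px | y , qy = begin
  isTop (fromTable t ∘⟨ p , q ⟩) i ≡⟨ isTop-maps (fromTable t ∘⟨ p , q ⟩) (fromTable-∘⟨,⟩-maps t p q px qy) ⟩
  isTopₛ (t x y)                  ≡⟨ table x y ⟩
  isTopₛ x • isTopₛ y              ≡⟨ sym (cong₂ _•_ (isTop-maps p px) (isTop-maps q qy)) ⟩
  isTop p i • isTop q i           ∎
  where open ≡-Reasoning

÷ℕ-self : ∀ a .{{_ : NonZero a}} → a ÷ℕ a ≡ 1ℚ
÷ℕ-self (suc a) = fromℚᵘ-cong {mkℚᵘ (ℤ.+ suc a) a} {ℚᵘ.1ℚᵘ} (*≡* (ℤ-*-comm (ℤ.+ suc a) (ℤ.+ 1)))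

÷ℕ-+ : ∀ a c d → (a ℕ.+ c) ÷ℕ d ≡ a ÷ℕ d + c ÷ℕ d
÷ℕ-+ a c zero    = sym (+-identityʳ 0ℚ)
÷ℕ-+ a c (suc d) = toℚᵘ-injective (begin
  toℚᵘ ((a ℕ.+ c) ÷ℕ suc d)                ≈⟨ toℚᵘ-fromℚᵘ (frac (a ℕ.+ c)) ⟩
  frac (a ℕ.+ c)                           ≈⟨ *≡* cross ⟩
  frac a ℚᵘ.+ frac c                       ≈⟨ ℚᵘ.+-cong (toℚᵘ-fromℚᵘ (frac a)) (toℚᵘ-fromℚᵘ (frac c)) ⟨
  toℚᵘ (a ÷ℕ suc d) ℚᵘ.+ toℚᵘ (c ÷ℕ suc d) ≈⟨ toℚᵘ-homo-+ (a ÷ℕ suc d) (c ÷ℕ suc d) ⟨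
  toℚᵘ (a ÷ℕ suc d + c ÷ℕ suc d)           ∎)
  where
  open ℚᵘ.≃-Reasoning
  open ℤ-Solver.+-*-Solver
  frac : ℕ → ℚᵘ.ℚᵘ
  frac x = mkℚᵘ (ℤ.+ x) d
  cross : ℤ.+ (a ℕ.+ c) ℤ.* (ℤ.+ suc d ℤ.* ℤ.+ suc d)
        ≡ (ℤ.+ a ℤ.* ℤ.+ suc d ℤ.+ ℤ.+ c ℤ.* ℤ.+ suc d) ℤ.* ℤ.+ suc d
  cross rewrite pos-+ a c =
    solve 3 (λ x y z → (x :+ y) :* (z :* z) := (x :* z :+ y :* z) :* z) refl (ℤ.+ a) (ℤ.+ c) (ℤ.+ suc d)

0÷ℕ : ∀ d → 0 ÷ℕ d ≡ 0ℚ
0÷ℕ zero    = refl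
0÷ℕ (suc d) = 0/n≡0 (suc d)

count-cong : ∀ n {f g : Fin n → Bool} → (∀ i → f i ≡ g i) → count n f ≡ count n g
count-cong zero    eq = refl
count-cong (suc n) eq =
  cong₂ ℕ._+_ (cong (λ b → if b then 1 else 0) (eq zero)) (count-cong n (λ i → eq (suc i)))

count-false : ∀ n → count n (λ _ → false) ≡ 0
count-false zero    = refl
count-false (suc n) = count-false n

count-pos : ∀ {n} (B : Fin n → Bool) {i} → B i ≡ true → 0 < count n B
count-pos {suc n} B {zero}  Bi rewrite Bi = z<s
count-pos {suc n} B {suc i} Bi = <-≤-trans (count-pos (λ a → B (suc a)) Bi) (m≤n+m _ _)

count-not-+ : ∀ n (B f : Fin n → Bool)
              → count n (λ i → B i ∧ not (f i)) ℕ.+ count n (λ i → B i ∧ f i) ≡ count n B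
count-not-+ zero    B f = refl
count-not-+ (suc n) B f with B zero | f zero
... | false | _     = count-not-+ n (λ i → B (suc i)) (λ i → f (suc i))
... | true  | false = cong suc (count-not-+ n (λ i → B (suc i)) (λ i → f (suc i)))
... | true  | true  =
  trans (+-suc _ _) (cong suc (count-not-+ n (λ i → B (suc i)) (λ i → f (suc i))))

-- 𝒥 cls r j is by definition freq (inBlock cls j) (isTop r).
freq : ∀ {n} → (Fin n → Bool) → (Fin n → Bool) → ℚ
freq {n} B f = count n (λ i → B i ∧ f i) ÷ℕ count n B

freq-cong : ∀ {n} {B f g : Fin n → Bool} → (∀ i → B i ≡ true → f i ≡ g i) → freq B f ≡ freq B g
freq-cong {n} {B} eq = cong (_÷ℕ count n B) (count-cong n (λ i → ∧-cong-on (B i) (eq i)))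
  where
  ∧-cong-on : ∀ b {x y} → (b ≡ true → x ≡ y) → (b ∧ x) ≡ (b ∧ y)
  ∧-cong-on false eq = refl
  ∧-cong-on true  eq = eq refl

freq-false : ∀ {n} (B : Fin n → Bool) → freq B (λ _ → false) ≡ 0ℚ
freq-false {n} B =
  trans (cong (_÷ℕ count n B) (trans (count-cong n (λ i → ∧-zeroʳ (B i))) (count-false n)))
        (0÷ℕ (count n B))

freq-true : ∀ {n} {B : Fin n → Bool} {i₀} → B i₀ ≡ true → freq B (λ _ → true) ≡ 1ℚ
freq-true {n} {B} Bi₀ =
  trans (cong (_÷ℕ count n B) (count-cong n (λ i → ∧-identityʳ (B i))))
        (÷ℕ-self (count n B) {{>-nonZero (count-pos B Bi₀)}})

freq-not : ∀ {n} {B : Fin n → Bool} {i₀} → B i₀ ≡ true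
           → (f : Fin n → Bool) → freq B (λ i → not (f i)) ≡ ¬ₐ (freq B f)
freq-not {n} {B} Bi₀ f = begin
  freq B not∘f                         ≡⟨ solve 2 (λ x y → x := (x :+ y) :- y) refl (freq B not∘f) (freq B f) ⟩
  (freq B not∘f + freq B f) - freq B f ≡⟨ cong (_- freq B f) complementary ⟩
  1ℚ - freq B f                        ∎
  where
  open ≡-Reasoning
  open +-*-Solver
  not∘f : Fin n → Bool
  not∘f i = not (f i)
  complementary : freq B not∘f + freq B f ≡ 1ℚ
  complementary = begin
    freq B not∘f + freq B f
      ≡⟨ ÷ℕ-+ (count n (λ i → B i ∧ not (f i))) (count n (λ i → B i ∧ f i)) (count n B) ⟨
    (count n (λ i → B i ∧ not (f i)) ℕ.+ count n (λ i → B i ∧ f i)) ÷ℕ count n B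
      ≡⟨ cong (_÷ℕ count n B) (count-not-+ n B f) ⟩
    count n B ÷ℕ count n B
      ≡⟨ ÷ℕ-self (count n B) {{>-nonZero (count-pos B Bi₀)}} ⟩
    1ℚ ∎

ConstantOn : ∀ {n} → (Fin n → Bool) → (Fin n → Bool) → Set
ConstantOn B f = Σ Bool (λ c → ∀ i → B i ≡ true → f i ≡ c)

ConstantOn-not : ∀ {n} {B f : Fin n → Bool} → ConstantOn B f → ConstantOn B (λ i → not (f i))
ConstantOn-not (c , f≡c) = not c , λ i Bi → cong not (f≡c i Bi)

freq-∧-constantˡ : ∀ {n} {B : Fin n → Bool} {i₀} → B i₀ ≡ true
                   → {f : Fin n → Bool} → ConstantOn B f → (g : Fin n → Bool)
                   → freq B (λ i → f i ∧ g i) ≡ freq B f ∧ₐ freq B g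
freq-∧-constantˡ {B = B} Bi₀ {f} (true , f≡c) g = begin
  freq B (λ i → f i ∧ g i) ≡⟨ freq-cong (λ i Bi → cong (_∧ g i) (f≡c i Bi)) ⟩
  freq B g                 ≡⟨ *-identityˡ (freq B g) ⟨
  1ℚ * freq B g            ≡⟨ cong (_* freq B g) (trans (freq-cong f≡c) (freq-true {B = B} Bi₀)) ⟨
  freq B f * freq B g      ∎
  where open ≡-Reasoning
freq-∧-constantˡ {B = B} Bi₀ {f} (false , f≡c) g = begin
  freq B (λ i → f i ∧ g i) ≡⟨ freq-cong (λ i Bi → cong (_∧ g i) (f≡c i Bi)) ⟩
  freq B (λ _ → false)     ≡⟨ freq-false B ⟩
  0ℚ                       ≡⟨ *-zeroˡ (freq B g) ⟨
  0ℚ * freq B g            ≡⟨ cong (_* freq B g) (trans (freq-cong f≡c) (freq-false B)) ⟨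
  freq B f * freq B g      ∎
  where open ≡-Reasoning

freq-∧ : ∀ {n} {B : Fin n → Bool} {i₀} → B i₀ ≡ true → {f g : Fin n → Bool}
         → ConstantOn B f ⊎ ConstantOn B g
         → freq B (λ i → f i ∧ g i) ≡ freq B f ∧ₐ freq B g
freq-∧ Bi₀ {g = g} (inj₁ f-const) = freq-∧-constantˡ Bi₀ f-const g
freq-∧ {B = B} Bi₀ {f} {g} (inj₂ g-const) = begin
  freq B (λ i → f i ∧ g i) ≡⟨ freq-cong (λ i _ → ∧-comm (f i) (g i)) ⟩
  freq B (λ i → g i ∧ f i) ≡⟨ freq-∧-constantˡ Bi₀ g-const f ⟩
  freq B g * freq B f      ≡⟨ *-comm (freq B g) (freq B f) ⟩
  freq B f * freq B g      ∎
  where open ≡-Reasoning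

∨-deMorgan : ∀ x y → (x ∨ y) ≡ not (not x ∧ not y)
∨-deMorgan true  y = refl
∨-deMorgan false y = sym (not-involutive y)

⇒-deMorgan : ∀ x y → (not x ∨ y) ≡ not (x ∧ not y)
⇒-deMorgan true  y = sym (not-involutive y)
⇒-deMorgan false y = refl

∨ₐ-deMorgan : ∀ α β → ¬ₐ (¬ₐ α ∧ₐ ¬ₐ β) ≡ α ∨ₐ β
∨ₐ-deMorgan = solve 2 (λ α β → con 1ℚ :- (con 1ℚ :- α) :* (con 1ℚ :- β) := (α :+ β) :- α :* β) refl
  where open +-*-Solver

→ₐ-deMorgan : ∀ α β → ¬ₐ (α ∧ₐ ¬ₐ β) ≡ α →ₐ β
→ₐ-deMorgan = solve 2 (λ α β → con 1ℚ :- α :* (con 1ℚ :- β) := (con 1ℚ :- α) :+ α :* β) refl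
  where open +-*-Solver

freq-∨ : ∀ {n} {B : Fin n → Bool} {i₀} → B i₀ ≡ true → {f g : Fin n → Bool}
         → ConstantOn B f ⊎ ConstantOn B g
         → freq B (λ i → f i ∨ g i) ≡ freq B f ∨ₐ freq B g
freq-∨ {B = B} Bi₀ {f} {g} const = begin
  freq B (λ i → f i ∨ g i)
    ≡⟨ freq-cong (λ i _ → ∨-deMorgan (f i) (g i)) ⟩
  freq B (λ i → not (not (f i) ∧ not (g i)))
    ≡⟨ freq-not Bi₀ (λ i → not (f i) ∧ not (g i)) ⟩
  ¬ₐ (freq B (λ i → not (f i) ∧ not (g i)))
    ≡⟨ cong ¬ₐ (freq-∧ Bi₀ (Sum.map ConstantOn-not ConstantOn-not const)) ⟩
  ¬ₐ (freq B (λ i → not (f i)) ∧ₐ freq B (λ i → not (g i)))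
    ≡⟨ cong₂ (λ α β → ¬ₐ (α ∧ₐ β)) (freq-not Bi₀ f) (freq-not Bi₀ g) ⟩
  ¬ₐ (¬ₐ (freq B f) ∧ₐ ¬ₐ (freq B g))
    ≡⟨ ∨ₐ-deMorgan (freq B f) (freq B g) ⟩
  freq B f ∨ₐ freq B g ∎
  where open ≡-Reasoning

freq-⇒ : ∀ {n} {B : Fin n → Bool} {i₀} → B i₀ ≡ true → {f g : Fin n → Bool}
         → ConstantOn B f ⊎ ConstantOn B g
         → freq B (λ i → not (f i) ∨ g i) ≡ freq B f →ₐ freq B g
freq-⇒ {B = B} Bi₀ {f} {g} const = begin
  freq B (λ i → not (f i) ∨ g i)
    ≡⟨ freq-cong (λ i _ → ⇒-deMorgan (f i) (g i)) ⟩
  freq B (λ i → not (f i ∧ not (g i)))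
    ≡⟨ freq-not Bi₀ (λ i → f i ∧ not (g i)) ⟩
  ¬ₐ (freq B (λ i → f i ∧ not (g i)))
    ≡⟨ cong ¬ₐ (freq-∧ Bi₀ (Sum.map₂ ConstantOn-not const)) ⟩
  ¬ₐ (freq B f ∧ₐ freq B (λ i → not (g i)))
    ≡⟨ cong (λ β → ¬ₐ (freq B f ∧ₐ β)) (freq-not Bi₀ g) ⟩
  ¬ₐ (freq B f ∧ₐ ¬ₐ (freq B g))
    ≡⟨ →ₐ-deMorgan (freq B f) (freq B g) ⟩
  freq B f →ₐ freq B g ∎
  where open ≡-Reasoning

inBlock-self : ∀ {n k} (cls : Fin n → Fin k) {i j} → cls i ≡ j → inBlock cls j i ≡ true
inBlock-self cls {i} {j} cls-i≡j with cls i ≟F j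
... | yes _      = refl
... | no cls-i≢j = contradiction cls-i≡j cls-i≢j

inBlock-sound : ∀ {n k} (cls : Fin n → Fin k) {i j} → inBlock cls j i ≡ true → cls i ≡ j
inBlock-sound cls {i} {j} _ with cls i ≟F j
inBlock-sound cls {i} {j} _  | yes cls-i≡j = cls-i≡j
inBlock-sound cls {i} {j} () | no _

isTop-cong : ∀ {n} (p : Lin (Fin n) S) {i i′} → (∀ s → p s i ≡ p s i′) → isTop p i ≡ isTop p i′
isTop-cong p eq = cong₂ (λ u v → ⌊ u ≟ℚ 1ℚ ⌋ ∧ ⌊ v ≟ℚ 0ℚ ⌋) (eq ⊤ₛ) (eq ⊥ₛ)

ConstOn⇒ConstantOn : ∀ {n k} {cls : Fin n → Fin k} {j i₀} → cls i₀ ≡ j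
                     → {p : Lin (Fin n) S} → ConstOn cls p j
                     → ConstantOn (inBlock cls j) (isTop p)
ConstOn⇒ConstantOn {cls = cls} {i₀ = i₀} cls-i₀≡j {p} const =
  isTop p i₀ , λ i Bi → isTop-cong p (const i i₀ (inBlock-sound cls Bi) cls-i₀≡j)

lemma1 : (n k : ℕ) (cls : Fin n → Fin k)
         → ((j : Fin k) → Σ (Fin n) (λ i → cls i ≡ j))
         → (p q : Lin (Fin n) S)
         → IsPredicate p → IsPredicate q
         → ((j : Fin k) → ConstOn cls p j ⊎ ConstOn cls q j)
         → ((j : Fin k) → 𝒥 cls (and ∘⟨ p , q ⟩) j ≡ (𝒥 cls p ∧ᵥ 𝒥 cls q) j)
           × ((j : Fin k) → 𝒥 cls (or ∘⟨ p , q ⟩) j ≡ (𝒥 cls p ∨ᵥ 𝒥 cls q) j)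
           × ((j : Fin k) → 𝒥 cls (ifthen ∘⟨ p , q ⟩) j ≡ (𝒥 cls p →ᵥ 𝒥 cls q) j)
lemma1 n k cls inhabited p q P Q const =
    (λ j → trans (𝒥-∘⟨,⟩ andT _∧_ isTopₛ-andT j) (freq-∧ (witness j) (constancy j)))
  , (λ j → trans (𝒥-∘⟨,⟩ orT _∨_ isTopₛ-orT j) (freq-∨ (witness j) (constancy j)))
  , (λ j → trans (𝒥-∘⟨,⟩ ifthenT (λ x y → not x ∨ y) isTopₛ-ifthenT j)
                 (freq-⇒ (witness j) (constancy j)))
  where
  witness : ∀ j → inBlock cls j (proj₁ (inhabited j)) ≡ true
  witness j = inBlock-self cls (proj₂ (inhabited j))

  constancy : ∀ j → ConstantOn (inBlock cls j) (isTop p) ⊎ ConstantOn (inBlock cls j) (isTop q)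
  constancy j = Sum.map (ConstOn⇒ConstantOn (proj₂ (inhabited j)))
                        (ConstOn⇒ConstantOn (proj₂ (inhabited j))) (const j)

  𝒥-∘⟨,⟩ : ∀ t (_•_ : Bool → Bool → Bool) → (∀ x y → isTopₛ (t x y) ≡ (isTopₛ x • isTopₛ y))
           → ∀ j → 𝒥 cls (fromTable t ∘⟨ p , q ⟩) j ≡ freq (inBlock cls j) (λ i → isTop p i • isTop q i)
  𝒥-∘⟨,⟩ t _•_ table j = freq-cong (λ i _ → isTop-∘⟨,⟩ t _•_ table P Q i)
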